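{- Let $D$ be the set of Dyck numbers and for $n\ge1$ let $E_n=\{t\in D:\ 2^{n-1}\le t\le 2^n-1\}$. For every even $n\ge 6$, $$E_n\cap\bigl(2^{n-1}-1+2^{n-3},\ 2^n-1\bigr]=\bigl(E_{n-2}+2^{n-1}\bigr)\cup\bigl(E_{n-1}+2^{n-1}\bigr)=\bigl(E_{n-2}+2^{n-1}\bigr)\cup\bigl(E_{n-2}+5\cdot 2^{n-3}\bigr)\cup\bigl(E_{n-2}+3\cdot 2^{n-2}\bigr),$$ where in the last union each translate lies entirely below the next; i.e. the level $E_n$ ends (in increasing order) with three consecutive shifted copies of $E_{n-2}$, the last two of which together form a shifted copy of $E_{n-1}$.
   Context: A Dyck number is a nonnegative integer $t$ such that every suffix of the binary representation of $t$ (i.e. every block of least significant bits) contains at least as many 1's as 0's; these form OEIS A036991: $0,1,3,5,7,11,13,15,19,21,\dots$. For a set $S$ of integers and an integer $c$, $S+c=\{s+c: s\in S\}$. -}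

module Defs where

open import Data.Nat using (ℕ; zero; suc; _+_; _*_; _∸_; _^_; _≤_; _<_; _%_; _/_)
open import Data.Bool using (Bool; true; false)
open import Data.List using (List; []; _∷_; take; length; filter)
open import Data.Product using (_×_; ∃-syntax)
open import Data.Sum using (_⊎_)
open import Relation.Binary.PropositionalEquality using (_≡_)
open import Relation.Nullary.Decidable using (does)
open import Data.Nat.Properties using (_≟_)

-- Binary digits of t, least significant bit first, without leading zeros
-- (so 0 has the empty representation). The first argument is fuel; t bits
-- of fuel always suffice since t/2 < t for t > 0.
bitsAux : ℕ → ℕ → List Bool
bitsAux zero    _       = []
bitsAux (suc f) zero    = []
bitsAux (suc f) (suc t) = does (suc t % 2 ≟ 1) ∷ bitsAux f (suc t / 2)

bits : ℕ → List Bool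
bits t = bitsAux t t

ones : List Bool → ℕ
ones []           = 0
ones (true  ∷ bs) = suc (ones bs)
ones (false ∷ bs) = ones bs

zeros : List Bool → ℕ
zeros []           = 0
zeros (true  ∷ bs) = zeros bs
zeros (false ∷ bs) = suc (zeros bs)

Dyck : ℕ → Set
Dyck t = ∀ k → zeros (take k (bits t)) ≤ ones (take k (bits t))

E : ℕ → ℕ → Set
E n t = Dyck t × 2 ^ (n ∸ 1) ≤ t × t ≤ 2 ^ n ∸ 1

_+ₛ_∋_ : (ℕ → Set) → ℕ → ℕ → Set
(S +ₛ c ∋ t) = ∃[ s ] (S s × t ≡ s + c)

-- Reading binary digits from the least significant end, t is a Dyck number iff the
-- running count (#1 − #0) never becomes negative. If r < 2^k then 2^k·m + r has the
-- low k digits of r followed by the digits of m, so whether 2^k·m + r is Dyck depends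
-- only on r, as long as the digits of m are admissible from the count c reached after
-- the low k digits. For m = 3, 5, 7 (digits 11, 101, 111) this holds for every c; for
-- m = 6 (digits 011, least significant first) it needs c > 0, which holds when k is odd
-- because c ≡ k (mod 2). With n = k + 3 and A = 2^k, the upper part (4A − 1 + A, 8A − 1]
-- of E_n is the union of the blocks [mA, (m+1)A) for m = 5, 6, 7; the block for m = 5 is
-- E_{n-2} + 4A, and those for m = 6, 7 form [6A, 8A) = E_{n-1} + 4A.
module Submission where

open import Defs
open import Data.Bool using (Bool; true; false)
open import Data.Empty using (⊥)
open import Data.List using (List; []; _∷_; _++_; length; take)
open import Data.Nat using (ℕ; zero; suc; _+_; _*_; _∸_; _^_; _≤_; _<_; _%_; _/_; z≤n; s≤s; s≤s⁻¹; _<?_)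
open import Data.Nat.DivMod using ([m+kn]%n≡m%n; +-distrib-/-∣ʳ; m*n/n≡m; m/n<m; m<n*o⇒m/o<n)
open import Data.Nat.Divisibility using (_∣_; divides; divides-refl; ∣m+n∣m⇒∣n)
open import Data.Nat.Properties
open import Data.Nat.Tactic.RingSolver using (solve-∀)
open import Data.Product using (_×_; _,_; proj₁; uncurry′; ∃-syntax)
open import Data.Product.Algebra using (×-distribˡ-⊎)
open import Data.Product.Function.NonDependent.Propositional using (_×-⇔_)
open import Data.Sum using (_⊎_; inj₁; inj₂)
open import Data.Sum.Function.Propositional using (_⊎-⇔_)
open import Data.Unit using (⊤; tt)
open import Function using (_∘_; id)
open import Function.Bundles using (_⇔_; mk⇔; Equivalence)
open import Function.Properties.Equivalence using () renaming (refl to ⇔-refl; trans to ⇔-trans; sym to ⇔-sym)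
open import Function.Properties.Inverse using (↔⇒⇔)
open import Level using (0ℓ)
open import Relation.Binary.PropositionalEquality
open import Relation.Nullary using (¬_; yes; no)
open import Relation.Nullary.Decidable using (does)

open Equivalence using (to; from)

half-suc≤ : ∀ t → suc t / 2 ≤ t
half-suc≤ t = s≤s⁻¹ (m/n<m (suc t) 2 (s≤s (s≤s z≤n)))

bitsAux-fuel : ∀ f g t → t ≤ f → t ≤ g → bitsAux f t ≡ bitsAux g t
bitsAux-fuel zero    zero    t       _       _       = refl
bitsAux-fuel zero    (suc g) zero    _       _       = refl
bitsAux-fuel (suc f) zero    zero    _       _       = refl
bitsAux-fuel (suc f) (suc g) zero    _       _       = refl
bitsAux-fuel (suc f) (suc g) (suc t) (s≤s t≤f) (s≤s t≤g) =
  cong (does (suc t % 2 ≟ 1) ∷_)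
       (bitsAux-fuel f g (suc t / 2) (≤-trans (half-suc≤ t) t≤f) (≤-trans (half-suc≤ t) t≤g))

bits-unfold : ∀ t → 0 < t → bits t ≡ does (t % 2 ≟ 1) ∷ bits (t / 2)
bits-unfold (suc t) _ =
  cong (does (suc t % 2 ≟ 1) ∷_) (bitsAux-fuel t (suc t / 2) (suc t / 2) (half-suc≤ t) ≤-refl)

lowBits : ℕ → ℕ → List Bool
lowBits zero    r = []
lowBits (suc k) r = does (r % 2 ≟ 1) ∷ lowBits k (r / 2)

length-lowBits : ∀ k r → length (lowBits k r) ≡ k
length-lowBits zero    r = refl
length-lowBits (suc k) r = cong suc (length-lowBits k (r / 2))

bits-scaled : ∀ k m r → 0 < m → r < 2 ^ k → bits (2 ^ k * m + r) ≡ lowBits k r ++ bits m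
bits-scaled zero    m zero    0<m _ = cong bits (trans (+-identityʳ _) (*-identityˡ m))
bits-scaled zero    m (suc r) 0<m (s≤s ())
bits-scaled (suc k) m r 0<m r<2^[1+k] = begin
    bits (2 ^ suc k * m + r)
  ≡⟨ cong bits (regroup (2 ^ k) m r) ⟩
    bits (r + x * 2)
  ≡⟨ bits-unfold (r + x * 2) (<-≤-trans 0<x*2 (m≤n+m (x * 2) r)) ⟩
    does ((r + x * 2) % 2 ≟ 1) ∷ bits ((r + x * 2) / 2)
  ≡⟨ cong₂ (λ b q → does (b ≟ 1) ∷ bits q) ([m+kn]%n≡m%n r x 2) [r+x*2]/2≡x+r/2 ⟩
    does (r % 2 ≟ 1) ∷ bits (x + r / 2)
  ≡⟨ cong (does (r % 2 ≟ 1) ∷_) (bits-scaled k m (r / 2) 0<m r/2<2^k) ⟩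
    lowBits (suc k) r ++ bits m
  ∎
  where
  open ≡-Reasoning
  x = 2 ^ k * m
  regroup : ∀ a m r → (2 * a) * m + r ≡ r + (a * m) * 2
  regroup = solve-∀
  0<x*2 : 0 < x * 2
  0<x*2 = *-mono-≤ (*-mono-≤ (m^n>0 2 k) 0<m) (s≤s z≤n)
  [r+x*2]/2≡x+r/2 : (r + x * 2) / 2 ≡ x + r / 2
  [r+x*2]/2≡x+r/2 = trans (+-distrib-/-∣ʳ r (divides-refl x))
                          (trans (cong (r / 2 +_) (m*n/n≡m x 2)) (+-comm (r / 2) x))
  r/2<2^k : r / 2 < 2 ^ k
  r/2<2^k = m<n*o⇒m/o<n (subst (r <_) (*-comm 2 (2 ^ k)) r<2^[1+k])

Ballot : ℕ → List Bool → Set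
Ballot d       []           = ⊤
Ballot d       (true  ∷ L)  = Ballot (suc d) L
Ballot zero    (false ∷ L)  = ⊥
Ballot (suc d) (false ∷ L)  = Ballot d L

-- The final count; junk 0 once the count would go negative, i.e. when ¬ Ballot d L.
lead : ℕ → List Bool → ℕ
lead d       []          = d
lead d       (true  ∷ L) = lead (suc d) L
lead zero    (false ∷ L) = 0
lead (suc d) (false ∷ L) = lead d L

prefixCounts⇔Ballot : ∀ d L → (∀ k → zeros (take k L) ≤ d + ones (take k L)) ⇔ Ballot d L
prefixCounts⇔Ballot d L = mk⇔ (prefixCounts⇒Ballot d L) (Ballot⇒prefixCounts d L)
  where
  prefixCounts⇒Ballot : ∀ d L → (∀ k → zeros (take k L) ≤ d + ones (take k L)) → Ballot d L
  prefixCounts⇒Ballot d       []          h = tt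
  prefixCounts⇒Ballot d       (true  ∷ L) h =
    prefixCounts⇒Ballot (suc d) L (λ k → subst (zeros (take k L) ≤_) (+-suc d _) (h (suc k)))
  prefixCounts⇒Ballot zero    (false ∷ L) h with h 1
  ... | ()
  prefixCounts⇒Ballot (suc d) (false ∷ L) h = prefixCounts⇒Ballot d L (λ k → s≤s⁻¹ (h (suc k)))

  Ballot⇒prefixCounts : ∀ d L → Ballot d L → ∀ k → zeros (take k L) ≤ d + ones (take k L)
  Ballot⇒prefixCounts d       L           b zero    = z≤n
  Ballot⇒prefixCounts d       []          b (suc k) = z≤n
  Ballot⇒prefixCounts d       (true  ∷ L) b (suc k) =
    subst (zeros (take k L) ≤_) (sym (+-suc d _)) (Ballot⇒prefixCounts (suc d) L b k)
  Ballot⇒prefixCounts (suc d) (false ∷ L) b (suc k) = s≤s (Ballot⇒prefixCounts d L b k)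

Dyck⇔Ballot : ∀ t → Dyck t ⇔ Ballot 0 (bits t)
Dyck⇔Ballot t = prefixCounts⇔Ballot 0 (bits t)

Ballot-++ : ∀ d L M → Ballot d (L ++ M) ⇔ (Ballot d L × Ballot (lead d L) M)
Ballot-++ d L M = mk⇔ (split d L) (uncurry′ (join d L))
  where
  split : ∀ d L → Ballot d (L ++ M) → Ballot d L × Ballot (lead d L) M
  split d       []          b = tt , b
  split d       (true  ∷ L) b = split (suc d) L b
  split (suc d) (false ∷ L) b = split d L b

  join : ∀ d L → Ballot d L → Ballot (lead d L) M → Ballot d (L ++ M)
  join d       []          _ b = b
  join d       (true  ∷ L) a b = join (suc d) L a b
  join (suc d) (false ∷ L) a b = join d L a b

lead+2*zeros : ∀ d L → Ballot d L → lead d L + 2 * zeros L ≡ d + length L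
lead+2*zeros d       []          _ = refl
lead+2*zeros d       (true  ∷ L) b = trans (lead+2*zeros (suc d) L b) (sym (+-suc d (length L)))
lead+2*zeros (suc d) (false ∷ L) b = begin
    lead d L + 2 * suc (zeros L)        ≡⟨ two-more (lead d L) (zeros L) ⟩
    suc (suc (lead d L + 2 * zeros L))  ≡⟨ cong (suc ∘ suc) (lead+2*zeros d L b) ⟩
    suc (suc (d + length L))            ≡⟨ cong suc (sym (+-suc d (length L))) ⟩
    suc d + length (false ∷ L)          ∎
  where
  open ≡-Reasoning
  two-more : ∀ a z → a + 2 * suc z ≡ suc (suc (a + 2 * z))
  two-more = solve-∀

lead-pos : ∀ L → Ballot 0 L → ¬ 2 ∣ length L → 0 < lead 0 L
lead-pos L b odd = n≢0⇒n>0 λ lead≡0 →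
  odd (divides (zeros L) (trans (sym (lead+2*zeros 0 L b))
                                (trans (cong (_+ 2 * zeros L) lead≡0) (*-comm 2 (zeros L)))))

Dyck-scaled⇔ : ∀ k m r → 0 < m → r < 2 ^ k →
  Dyck (2 ^ k * m + r) ⇔ (Ballot 0 (lowBits k r) × Ballot (lead 0 (lowBits k r)) (bits m))
Dyck-scaled⇔ k m r 0<m r<2^k = ⇔-trans
  (subst (λ L → Dyck (2 ^ k * m + r) ⇔ Ballot 0 L) (bits-scaled k m r 0<m r<2^k)
         (Dyck⇔Ballot (2 ^ k * m + r)))
  (Ballot-++ 0 (lowBits k r) (bits m))

Dyck-rescale : ∀ k m r → 0 < m → r < 2 ^ k →
  (Ballot 0 (lowBits k r) → Ballot (lead 0 (lowBits k r)) (bits m)) →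
  Dyck (2 ^ k * m + r) ⇔ Dyck (2 ^ k * 1 + r)
Dyck-rescale k m r 0<m r<2^k admissible = mk⇔
  (λ d → from scaled₁ (proj₁ (to scaledₘ d) , tt))
  (λ d → let b = proj₁ (to scaled₁ d) in from scaledₘ (b , admissible b))
  where
  X = lowBits k r
  scaledₘ : Dyck (2 ^ k * m + r) ⇔ (Ballot 0 X × Ballot (lead 0 X) (bits m))
  scaledₘ = Dyck-scaled⇔ k m r 0<m r<2^k
  scaled₁ : Dyck (2 ^ k * 1 + r) ⇔ (Ballot 0 X × Ballot (lead 0 X) (bits 1))
  scaled₁ = Dyck-scaled⇔ k 1 r (s≤s z≤n) r<2^k

Block : ℕ → ℕ → ℕ → Set
Block k m t = 2 ^ k * m ≤ t × t < 2 ^ k * suc m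

Block⇔offset : ∀ k m t → Block k m t ⇔ (∃[ r ] (r < 2 ^ k × t ≡ 2 ^ k * m + r))
Block⇔offset k m t = mk⇔
  (λ (lo , hi) → t ∸ 2 ^ k * m
               , +-cancelˡ-< (2 ^ k * m) _ _
                   (subst₂ _<_ (sym (m+[n∸m]≡n lo)) (trans (*-suc (2 ^ k) m) (+-comm (2 ^ k) _)) hi)
               , sym (m+[n∸m]≡n lo))
  (λ (r , r<2^k , t≡) → subst (Block k m) (sym t≡)
     ( m≤m+n (2 ^ k * m) r
     , subst (2 ^ k * m + r <_) (trans (+-comm _ (2 ^ k)) (sym (*-suc (2 ^ k) m))) (+-monoʳ-< (2 ^ k * m) r<2^k)))

interval-split : ∀ {a b c t} → a ≤ b → b ≤ c →
  (a ≤ t × t < c) ⇔ ((a ≤ t × t < b) ⊎ (b ≤ t × t < c))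
interval-split {a} {b} {c} {t} a≤b b≤c = mk⇔ split join
  where
  split : a ≤ t × t < c → (a ≤ t × t < b) ⊎ (b ≤ t × t < c)
  split (a≤t , t<c) with t <? b
  ... | yes t<b = inj₁ (a≤t , t<b)
  ... | no  t≮b = inj₂ (≮⇒≥ t≮b , t<c)
  join : (a ≤ t × t < b) ⊎ (b ≤ t × t < c) → a ≤ t × t < c
  join (inj₁ (a≤t , t<b)) = a≤t , <-≤-trans t<b b≤c
  join (inj₂ (b≤t , t<c)) = ≤-trans a≤b b≤t , t<c

Block-split : ∀ k m t → Block (suc k) m t ⇔ (Block k (2 * m) t ⊎ Block k (suc (2 * m)) t)
Block-split k m t =
  subst₂ (λ lo hi → (lo ≤ t × t < hi) ⇔ (Block k (2 * m) t ⊎ Block k (suc (2 * m)) t))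
         (sym (lower (2 ^ k) m)) (sym (upper (2 ^ k) m))
         (interval-split (*-monoʳ-≤ (2 ^ k) (n≤1+n (2 * m))) (*-monoʳ-≤ (2 ^ k) (n≤1+n (suc (2 * m)))))
  where
  lower : ∀ a m → (2 * a) * m ≡ a * (2 * m)
  lower = solve-∀
  upper : ∀ a m → (2 * a) * suc m ≡ a * suc (suc (2 * m))
  upper = solve-∀

≤∸1⇔< : ∀ {x y} → 0 < y → (x ≤ y ∸ 1) ⇔ (x < y)
≤∸1⇔< {y = suc y} _ = mk⇔ s≤s s≤s⁻¹

∸1+<⇔ : ∀ {x y t} → 0 < y → (y ∸ 1 + x < t) ⇔ (y + x ≤ t)
∸1+<⇔ {y = suc y} _ = mk⇔ id id

E⇔Block : ∀ k t → E (suc k) t ⇔ (Dyck t × Block k 1 t)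
E⇔Block k t = mk⇔
  (λ (d , lo , hi) → d , subst (_≤ t) (sym (*-identityʳ (2 ^ k))) lo
                       , subst (t <_) (*-comm 2 (2 ^ k)) (to (≤∸1⇔< (m^n>0 2 (suc k))) hi))
  (λ (d , lo , hi) → d , subst (_≤ t) (*-identityʳ (2 ^ k)) lo
                       , from (≤∸1⇔< (m^n>0 2 (suc k))) (subst (t <_) (*-comm (2 ^ k) 2) hi))

E-translate : ∀ k j c t → c ≡ 2 ^ k * j →
  (∀ r → r < 2 ^ k → Dyck (2 ^ k * suc j + r) ⇔ Dyck (2 ^ k * 1 + r)) →
  (E (suc k) +ₛ c ∋ t) ⇔ (Dyck t × Block k (suc j) t)
E-translate k j c t c≡ rescale = mk⇔
  (λ (s , Es , t≡s+c) →
    let (ds , s-block) = to (E⇔Block k s) Es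
        (r , r<2^k , s≡) = to (Block⇔offset k 1 s) s-block
        t≡ = trans t≡s+c (trans (cong₂ _+_ s≡ c≡) (sym (shift (2 ^ k) j r)))
    in subst Dyck (sym t≡) (from (rescale r r<2^k) (subst Dyck s≡ ds))
     , from (Block⇔offset k (suc j) t) (r , r<2^k , t≡))
  (λ (dt , t-block) →
    let (r , r<2^k , t≡) = to (Block⇔offset k (suc j) t) t-block
    in 2 ^ k * 1 + r
     , from (E⇔Block k _) (to (rescale r r<2^k) (subst Dyck t≡ dt) , from (Block⇔offset k 1 _) (r , r<2^k , refl))
     , trans t≡ (trans (shift (2 ^ k) j r) (cong (2 ^ k * 1 + r +_) (sym c≡))))
  where
  shift : ∀ a j r → a * suc j + r ≡ (a * 1 + r) + a * j
  shift = solve-∀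

E-translates-ordered : ∀ k {a b c d} → d ≡ 2 ^ k + c → E (suc k) a → E (suc k) b → a + c < b + d
E-translates-ordered k {a} {b} {c} {d} d≡ (_ , _ , a≤) (_ , 2^k≤b , _) = begin-strict
    a + c             <⟨ +-monoˡ-< c (to (≤∸1⇔< (m^n>0 2 (suc k))) a≤) ⟩
    2 ^ suc k + c     ≡⟨ double (2 ^ k) c ⟩
    2 ^ k + (2 ^ k + c) ≤⟨ +-monoˡ-≤ (2 ^ k + c) 2^k≤b ⟩
    b + (2 ^ k + c)   ≡⟨ cong (b +_) (sym d≡) ⟩
    b + d             ∎
  where
  open ≤-Reasoning
  double : ∀ a c → 2 * a + c ≡ a + (a + c)
  double = solve-∀

upper-E⇔ : ∀ w t →
  (E (3 + w) t × (2 ^ (2 + w) ∸ 1 + 2 ^ w < t × t ≤ 2 ^ (3 + w) ∸ 1))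
    ⇔ (Dyck t × (Block w 5 t ⊎ Block (suc w) 3 t))
upper-E⇔ w t = mk⇔
  (λ ((d , _ , _) , lo , hi) →
    d , to window ( subst (_≤ t) (4a+a≡a*5 (2 ^ w)) (to (∸1+<⇔ (m^n>0 2 (2 + w))) lo)
                  , subst (t <_) (8a≡2a*4 (2 ^ w)) (to (≤∸1⇔< (m^n>0 2 (3 + w))) hi)))
  (λ (d , blk) →
    let (lo , hi) = from window blk
        hi′ = from (≤∸1⇔< (m^n>0 2 (3 + w))) (subst (t <_) (sym (8a≡2a*4 (2 ^ w))) hi)
    in (d , ≤-trans (4a≤a*5 (2 ^ w)) lo , hi′)
     , from (∸1+<⇔ (m^n>0 2 (2 + w))) (subst (_≤ t) (sym (4a+a≡a*5 (2 ^ w))) lo)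
     , hi′)
  where
  4a+a≡a*5 : ∀ a → 2 * (2 * a) + a ≡ a * 5
  4a+a≡a*5 = solve-∀
  8a≡2a*4 : ∀ a → 2 * (2 * (2 * a)) ≡ (2 * a) * 4
  8a≡2a*4 = solve-∀
  2a*3≡a*6 : ∀ a → (2 * a) * 3 ≡ a * 6
  2a*3≡a*6 = solve-∀
  4a≤a*5 : ∀ a → 2 * (2 * a) ≤ a * 5
  4a≤a*5 a = subst (2 * (2 * a) ≤_) (4a+a≡a*5 a) (m≤m+n (2 * (2 * a)) a)
  window : (2 ^ w * 5 ≤ t × t < (2 * 2 ^ w) * 4) ⇔ (Block w 5 t ⊎ Block (suc w) 3 t)
  window = subst (λ m → (2 ^ w * 5 ≤ t × t < (2 * 2 ^ w) * 4) ⇔ ((2 ^ w * 5 ≤ t × t < m) ⊎ Block (suc w) 3 t))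
                 (2a*3≡a*6 (2 ^ w))
                 (interval-split (subst (2 ^ w * 5 ≤_) (sym (2a*3≡a*6 (2 ^ w))) (*-monoʳ-≤ (2 ^ w) (n≤1+n 5)))
                                 (*-monoʳ-≤ (2 * 2 ^ w) (n≤1+n 3)))

2∤3 : ¬ 2 ∣ 3
2∤3 (divides (suc (suc q)) ())

odd-of-even+3 : ∀ w → 2 ∣ 3 + w → ¬ 2 ∣ w
odd-of-even+3 w 2∣3+w 2∣w = 2∤3 (∣m+n∣m⇒∣n (subst (2 ∣_) (+-comm 3 w) 2∣3+w) 2∣w)

Ballot-011 : ∀ {d} → 0 < d → Ballot d (false ∷ true ∷ true ∷ [])
Ballot-011 {suc d} _ = tt

translate₅ : ∀ w t → (E (suc w) +ₛ 2 ^ (2 + w) ∋ t) ⇔ (Dyck t × Block w 5 t)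
translate₅ w t = E-translate w 4 _ t (4a≡a*4 (2 ^ w)) λ r r<2^w →
  Dyck-rescale w 5 r (s≤s z≤n) r<2^w λ _ → tt
  where
  4a≡a*4 : ∀ a → 2 * (2 * a) ≡ a * 4
  4a≡a*4 = solve-∀

translate₃ : ∀ w t → (E (2 + w) +ₛ 2 ^ (2 + w) ∋ t) ⇔ (Dyck t × Block (suc w) 3 t)
translate₃ w t = E-translate (suc w) 2 _ t (*-comm 2 (2 ^ suc w)) λ r r<2^[1+w] →
  Dyck-rescale (suc w) 3 r (s≤s z≤n) r<2^[1+w] λ _ → tt

translate₆ : ∀ w t → ¬ 2 ∣ w → (E (suc w) +ₛ 5 * 2 ^ w ∋ t) ⇔ (Dyck t × Block w 6 t)
translate₆ w t odd = E-translate w 5 _ t (*-comm 5 (2 ^ w)) λ r r<2^w →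
  Dyck-rescale w 6 r (s≤s z≤n) r<2^w λ b →
    Ballot-011 (lead-pos (lowBits w r) b (subst (¬_ ∘ (2 ∣_)) (sym (length-lowBits w r)) odd))

translate₇ : ∀ w t → (E (suc w) +ₛ 3 * 2 ^ suc w ∋ t) ⇔ (Dyck t × Block w 7 t)
translate₇ w t = E-translate w 6 _ t (6a≡a*6 (2 ^ w)) λ r r<2^w →
  Dyck-rescale w 7 r (s≤s z≤n) r<2^w λ _ → tt
  where
  6a≡a*6 : ∀ a → 3 * (2 * a) ≡ a * 6
  6a≡a*6 = solve-∀

translates-ordered : ∀ w a b → E (suc w) a → E (suc w) b →
  (a + 2 ^ (2 + w) < b + 5 * 2 ^ w) × (a + 5 * 2 ^ w < b + 3 * 2 ^ suc w)
translates-ordered w a b Ea Eb =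
  E-translates-ordered w (5a≡a+4a (2 ^ w)) Ea Eb , E-translates-ordered w (6a≡a+5a (2 ^ w)) Ea Eb
  where
  5a≡a+4a : ∀ a → 5 * a ≡ a + 2 * (2 * a)
  5a≡a+4a = solve-∀
  6a≡a+5a : ∀ a → 3 * (2 * a) ≡ a + 5 * a
  6a≡a+5a = solve-∀

×-distribˡ-⊎⇔ : ∀ {P Q R : Set} → (P × (Q ⊎ R)) ⇔ ((P × Q) ⊎ (P × R))
×-distribˡ-⊎⇔ = ↔⇒⇔ (×-distribˡ-⊎ 0ℓ _ _ _)

proposition8 : ∀ (n : ℕ) → 6 ≤ n → 2 ∣ n →
  (∀ (t : ℕ) →
    ((E n t × (2 ^ (n ∸ 1) ∸ 1 + 2 ^ (n ∸ 3) < t × t ≤ 2 ^ n ∸ 1))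
      ⇔ ((E (n ∸ 2) +ₛ 2 ^ (n ∸ 1) ∋ t) ⊎ (E (n ∸ 1) +ₛ 2 ^ (n ∸ 1) ∋ t)))
    × (((E (n ∸ 2) +ₛ 2 ^ (n ∸ 1) ∋ t) ⊎ (E (n ∸ 1) +ₛ 2 ^ (n ∸ 1) ∋ t))
      ⇔ ((E (n ∸ 2) +ₛ 2 ^ (n ∸ 1) ∋ t)
        ⊎ ((E (n ∸ 2) +ₛ 5 * 2 ^ (n ∸ 3) ∋ t) ⊎ (E (n ∸ 2) +ₛ 3 * 2 ^ (n ∸ 2) ∋ t)))))
  × (∀ (a b : ℕ) → E (n ∸ 2) a → E (n ∸ 2) b →
      (a + 2 ^ (n ∸ 1) < b + 5 * 2 ^ (n ∸ 3))
      × (a + 5 * 2 ^ (n ∸ 3) < b + 3 * 2 ^ (n ∸ 2)))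
proposition8 (suc (suc (suc w))) (s≤s (s≤s (s≤s _))) 2∣n =
  (λ t → ⇔-trans (upper-E⇔ w t) (⇔-trans ×-distribˡ-⊎⇔ (⇔-sym (translate₅ w t ⊎-⇔ translate₃ w t)))
       , ⇔-trans (translate₅ w t ⊎-⇔ translate₃ w t)
           (⇔-trans (⇔-refl ⊎-⇔ ⇔-trans (⇔-refl ×-⇔ Block-split w 3 t) ×-distribˡ-⊎⇔)
                    (⇔-sym (translate₅ w t ⊎-⇔ (translate₆ w t (odd-of-even+3 w 2∣n) ⊎-⇔ translate₇ w t)))))
  , translates-ordered w
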